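{- Let $m,n\geq 0$. For $\mathbf{u},\mathbf{v}\in\mathsf{Shuf}(m,n)$, $\mathbf{v}$ covers $\mathbf{u}$ in $\mathbf{Bub}(m,n)$ (written $\mathbf{u}\lessdot_{\mathsf{bub}}\mathbf{v}$) if and only if either $\mathbf{u}\Rightarrow\mathbf{v}$ or $\mathbf{u}\hookrightarrow\mathbf{v}$.
   Context: Disjoint alphabets $X=\{x_1,\dots,x_m\}$, $Y=\{y_1,\dots,y_n\}$. A word is simple if it has no repeated letter; $\mathsf{Shuf}(m,n)$ is the set of simple words over $X\cup Y$ in which the letters of $X$ appear in increasing order of index and those of $Y$ in increasing order of index. For $\mathbf{u}=u_1\cdots u_k$, $\mathbf{u}_{\hat\imath}$ is $\mathbf{u}$ with $u_i$ deleted. Indels: $\mathbf{u}\to\mathbf{u}_{\hat\imath}$ if $u_i\in X$, and $\mathbf{u}_{\hat\imath}\to\mathbf{u}$ if $u_i\in Y$. Transpositions: $\mathbf{u}\Rightarrow\mathbf{u}'$ where $u_i\in X$, $u_{i+1}\in Y$ and $\mathbf{u}'$ is $\mathbf{u}$ with $u_i,u_{i+1}$ swapped. The bubble order $\leq_{\mathsf{bub}}$ is the reflexive transitive closure of indels and transpositions; $\mathbf{Bub}(m,n)=(\mathsf{Shuf}(m,n),\leq_{\mathsf{bub}})$. Right indels: for $\mathbf{u}=u_1\cdots u_k\in\mathsf{Shuf}(m,n)$ and $i\in[k]$, $\mathbf{u}\hookrightarrow\mathbf{u}_{\hat\imath}$ if $u_i\in X$ and either $i=k$ or $u_{i+1}\in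 X$; and $\mathbf{u}_{\hat\imath}\hookrightarrow\mathbf{u}$ if $u_i\in Y$ and either $i=k$ or $u_{i+1}\in Y$. -}

module Defs where

open import Data.Nat using (ℕ)
open import Data.Fin using (Fin) renaming (_<_ to _<ᶠ_)
open import Data.List using (List; []; _∷_; _++_)
open import Data.Maybe using (Maybe; just; nothing)
open import Data.List using (mapMaybe)
open import Data.List.Relation.Unary.Unique.Propositional using (Unique)
open import Data.List.Relation.Unary.Linked using (Linked)
open import Data.Product using (Σ; _×_; ∃-syntax)
open import Data.Sum using (_⊎_)
open import Relation.Binary.PropositionalEquality using (_≡_)
open import Relation.Binary.Construct.Closure.ReflexiveTransitive using (Star)
open import Relation.Nullary using (¬_)

-- Letters of X ∪ Y : x i (i : Fin m) is x_{i+1}, y j (j : Fin n) is y_{j+1}.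
data Letter (m n : ℕ) : Set where
  x : Fin m → Letter m n
  y : Fin n → Letter m n

Word : ℕ → ℕ → Set
Word m n = List (Letter m n)

data IsX {m n : ℕ} : Letter m n → Set where
  isX : (i : Fin m) → IsX (x i)

data IsY {m n : ℕ} : Letter m n → Set where
  isY : (j : Fin n) → IsY (y j)

xIndex : {m n : ℕ} → Letter m n → Maybe (Fin m)
xIndex (x i) = just i
xIndex (y _) = nothing

yIndex : {m n : ℕ} → Letter m n → Maybe (Fin n)
yIndex (x _) = nothing
yIndex (y j) = just j

Shuf : {m n : ℕ} → Word m n → Set
Shuf u = Unique u
       × Linked _<ᶠ_ (mapMaybe xIndex u)
       × Linked _<ᶠ_ (mapMaybe yIndex u)

data Indel {m n : ℕ} : Word m n → Word m n → Set where
  del : (p s : Word m n) (a : Letter m n) → IsX a →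
        Indel (p ++ a ∷ s) (p ++ s)
  ins : (p s : Word m n) (a : Letter m n) → IsY a →
        Indel (p ++ s) (p ++ a ∷ s)

data Transp {m n : ℕ} : Word m n → Word m n → Set where
  swap : (p s : Word m n) (a b : Letter m n) → IsX a → IsY b →
         Transp (p ++ a ∷ b ∷ s) (p ++ b ∷ a ∷ s)

-- "either i = k or u_{i+1} ∈ X" for the suffix s following u_i
data EndOrX {m n : ℕ} : Word m n → Set where
  end : EndOrX []
  nxt : (b : Letter m n) (s : Word m n) → IsX b → EndOrX (b ∷ s)

data EndOrY {m n : ℕ} : Word m n → Set where
  end : EndOrY []
  nxt : (b : Letter m n) (s : Word m n) → IsY b → EndOrY (b ∷ s)

data RightIndel {m n : ℕ} : Word m n → Word m n → Set where
  rdel : (p s : Word m n) (a : Letter m n) → IsX a → EndOrX s →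
         RightIndel (p ++ a ∷ s) (p ++ s)
  rins : (p s : Word m n) (a : Letter m n) → IsY a → EndOrY s →
         RightIndel (p ++ s) (p ++ a ∷ s)

data BubStep {m n : ℕ} (u v : Word m n) : Set where
  indel  : Shuf u → Shuf v → Indel u v → BubStep u v
  transp : Shuf u → Shuf v → Transp u v → BubStep u v

_≤bub_ : {m n : ℕ} → Word m n → Word m n → Set
_≤bub_ = Star BubStep

_<bub_ : {m n : ℕ} → Word m n → Word m n → Set
u <bub v = u ≤bub v × ¬ (u ≡ v)

_⋖bub_ : {m n : ℕ} → Word m n → Word m n → Set
_⋖bub_ {m} {n} u v =
  u <bub v × ¬ (Σ (Word m n) λ w → Shuf w × u <bub w × w <bub v)

-- Every simple shuffle word is determined by the answers to three families of
-- yes/no questions: is x_i absent, is y_j present, and does y_j occur without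
-- an x_i before it.  Every elementary step of the bubble order can only turn
-- answers from false to true, so u ≤bub w ≤bub v squeezes the answers of w
-- between those of u and v.  A transposition changes a single answer; a right
-- deletion of x_k changes the answers about x_k, which in w are all forced by
-- whether x_k survives, because the letter after x_k (an x with larger index,
-- or the end of the word) bounds where y's may sit; dually for right
-- insertions.  Hence nothing lies strictly between u and v.  Conversely a cover
-- is a single step, and an indel that is not a right indel factors as a
-- transposition followed by an indel.

module Submission where

open import Defs
open import Data.Bool using (Bool; true; false; _≤_)
open import Data.Bool.Properties using (≤-refl; ≤-trans; ≤-antisym; ≤-minimum; ≤-maximum; ≤-reflexive; ≤-poset)
open import Data.Empty using (⊥-elim)
open import Data.Fin using (Fin; _≟_) renaming (_<_ to _<ᶠ_)
open import Data.Fin.Properties using (<-trans; <-asym; <⇒≢)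
open import Data.List using ([]; _∷_; _++_; [_]; map; catMaybes; mapMaybe; length)
open import Data.List.Properties using (∷-injectiveˡ; ++-cancelˡ; ++-assoc; ≡-dec; map-++; catMaybes-++)
open import Data.List.Relation.Binary.Permutation.Propositional using (module _↭_)
open import Data.List.Relation.Binary.Permutation.Propositional.Properties using (All-resp-↭; ++⁺ˡ)
open import Data.List.Relation.Unary.All using (All; []; _∷_)
import Data.List.Relation.Unary.All as All
open import Data.List.Relation.Unary.All.Properties using (++⁺; ++⁻ʳ)
open import Data.List.Relation.Unary.AllPairs using (_∷_)
import Data.List.Relation.Unary.AllPairs as AllPairs
open import Data.List.Relation.Unary.Linked using (Linked; _∷_)
import Data.List.Relation.Unary.Linked as Linked
open import Data.List.Relation.Unary.Unique.Propositional using (Unique)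
open import Data.Maybe using (Maybe; just; nothing; fromMaybe)
open import Data.Nat using (ℕ)
open import Data.Nat.Properties using (1+n≢n)
open import Data.Product using (Σ; _×_; _,_; proj₁; proj₂)
open import Data.Sum using (_⊎_; inj₁; inj₂) renaming ([_,_] to [_,_]′)
open import Function using (_∘_)
open import Function.Bundles using (_⇔_; mk⇔)
open import Relation.Binary.Definitions using (DecidableEquality)
open import Relation.Binary.PropositionalEquality using (_≡_; _≢_; refl; sym; trans; cong; subst; subst₂)
open import Relation.Binary.Construct.Closure.ReflexiveTransitive using (ε; _◅_)
open import Relation.Binary.Reasoning.PartialOrder ≤-poset
open import Relation.Nullary using (¬_; Dec; yes; no)
open import Relation.Nullary.Decidable using (map′)

true≢false : true ≢ false
true≢false ()

≡false⇒≤ : ∀ {a} b → a ≡ false → a ≤ b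
≡false⇒≤ b refl = ≤-minimum b

≡true⇒≥ : ∀ {a} b → a ≡ true → b ≤ a
≡true⇒≥ b refl = ≤-maximum b

module _ {m n : ℕ} where

  private
    variable
      u v w p r r′ s : Word m n

  data Query : Set where
    absentX  : Fin m → Query
    presentY : Fin n → Query
    yFirst   : Fin m → Fin n → Query

  stopIf : {P : Set} → Dec P → Bool → Maybe Bool
  stopIf (yes _) b = just b
  stopIf (no _)  _ = nothing

  stopIf-yes : ∀ {P : Set} (d : Dec P) {b} → P → stopIf d b ≡ just b
  stopIf-yes (yes _) _  = refl
  stopIf-yes (no ¬P) P = ⊥-elim (¬P P)

  stopIf-no : ∀ {P : Set} (d : Dec P) {b} → ¬ P → stopIf d b ≡ nothing
  stopIf-no (yes P) ¬P = ⊥-elim (¬P P)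
  stopIf-no (no _)  _  = refl

  -- A query is answered by the first letter of the word it reacts to
  -- (nothing = the letter is ignored), or by answerAtEnd if there is none.
  -- So ⟦ yFirst i j ⟧ w holds iff y_j occurs in w and x_i does not occur before it.
  hit : Query → Letter m n → Maybe Bool
  hit (absentX i)  (x k) = stopIf (k ≟ i) false
  hit (absentX i)  (y l) = nothing
  hit (presentY j) (x k) = nothing
  hit (presentY j) (y l) = stopIf (l ≟ j) true
  hit (yFirst i j) (x k) = stopIf (k ≟ i) false
  hit (yFirst i j) (y l) = stopIf (l ≟ j) true

  answerAtEnd : Query → Bool
  answerAtEnd (absentX _)  = true
  answerAtEnd (presentY _) = false
  answerAtEnd (yFirst _ _) = false

  ⟦_⟧ : Query → Word m n → Bool
  ⟦ q ⟧ []      = answerAtEnd q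
  ⟦ q ⟧ (a ∷ w) = fromMaybe (⟦ q ⟧ w) (hit q a)

  ⟦⟧-stop : ∀ {b} q a w → hit q a ≡ just b → ⟦ q ⟧ (a ∷ w) ≡ b
  ⟦⟧-stop q a w e = cong (fromMaybe _) e

  ⟦⟧-miss : ∀ q a w → hit q a ≡ nothing → ⟦ q ⟧ (a ∷ w) ≡ ⟦ q ⟧ w
  ⟦⟧-miss q a w e = cong (fromMaybe _) e

  absentX-here : ∀ i w → ⟦ absentX i ⟧ (x i ∷ w) ≡ false
  absentX-here i w = ⟦⟧-stop (absentX i) (x i) w (stopIf-yes (i ≟ i) refl)

  presentY-here : ∀ j w → ⟦ presentY j ⟧ (y j ∷ w) ≡ true
  presentY-here j w = ⟦⟧-stop (presentY j) (y j) w (stopIf-yes (j ≟ j) refl)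

  yFirst-here-x : ∀ i j w → ⟦ yFirst i j ⟧ (x i ∷ w) ≡ false
  yFirst-here-x i j w = ⟦⟧-stop (yFirst i j) (x i) w (stopIf-yes (i ≟ i) refl)

  yFirst-here-y : ∀ i j w → ⟦ yFirst i j ⟧ (y j ∷ w) ≡ true
  yFirst-here-y i j w = ⟦⟧-stop (yFirst i j) (y j) w (stopIf-yes (j ≟ j) refl)

  data XView (k : Fin m) : Query → Set where
    misses    : ∀ {q} → hit q (x k) ≡ nothing → XView k q
    absentX-k : XView k (absentX k)
    yFirst-k  : ∀ j → XView k (yFirst k j)

  xView : ∀ k q → XView k q
  xView k (absentX i) with k ≟ i
  ... | yes refl = absentX-k
  ... | no k≢i   = misses (stopIf-no (k ≟ i) k≢i)
  xView k (presentY j) = misses refl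
  xView k (yFirst i j) with k ≟ i
  ... | yes refl = yFirst-k j
  ... | no k≢i   = misses (stopIf-no (k ≟ i) k≢i)

  data YView (l : Fin n) : Query → Set where
    misses     : ∀ {q} → hit q (y l) ≡ nothing → YView l q
    presentY-l : YView l (presentY l)
    yFirst-l   : ∀ i → YView l (yFirst i l)

  yView : ∀ l q → YView l q
  yView l (absentX i) = misses refl
  yView l (presentY j) with l ≟ j
  ... | yes refl = presentY-l
  ... | no l≢j   = misses (stopIf-no (l ≟ j) l≢j)
  yView l (yFirst i j) with l ≟ j
  ... | yes refl = yFirst-l i
  ... | no l≢j   = misses (stopIf-no (l ≟ j) l≢j)

  ⟦⟧-++ : (R : Bool → Bool → Set) → (∀ {b} → R b b) → ∀ q q′ p →
          All (λ c → hit q c ≡ hit q′ c) p → R (⟦ q ⟧ r) (⟦ q′ ⟧ r′) →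
          R (⟦ q ⟧ (p ++ r)) (⟦ q′ ⟧ (p ++ r′))
  ⟦⟧-++ R R-refl q q′ []      []       h = h
  ⟦⟧-++ R R-refl q q′ (c ∷ p) (e ∷ es) h rewrite e with hit q′ c
  ... | just _  = R-refl
  ... | nothing = ⟦⟧-++ R R-refl q q′ p es h

  ⟦⟧-prefix-mono : ∀ q p → ⟦ q ⟧ r ≤ ⟦ q ⟧ r′ → ⟦ q ⟧ (p ++ r) ≤ ⟦ q ⟧ (p ++ r′)
  ⟦⟧-prefix-mono q p = ⟦⟧-++ _≤_ ≤-refl q q p (All.universal (λ _ → refl) p)

  ⟦⟧-prefix-cong : ∀ q p → ⟦ q ⟧ r ≡ ⟦ q ⟧ r′ → ⟦ q ⟧ (p ++ r) ≡ ⟦ q ⟧ (p ++ r′)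
  ⟦⟧-prefix-cong q p = ⟦⟧-++ _≡_ refl q q p (All.universal (λ _ → refl) p)

  ⟦⟧-++-∷-miss : ∀ {q a} p s → hit q a ≡ nothing → ⟦ q ⟧ (p ++ a ∷ s) ≡ ⟦ q ⟧ (p ++ s)
  ⟦⟧-++-∷-miss {q} p s e = ⟦⟧-prefix-cong q p (⟦⟧-miss q _ s e)

  x-lowers : ∀ q k w → ⟦ q ⟧ (x k ∷ w) ≤ ⟦ q ⟧ w
  x-lowers (absentX i) k w with k ≟ i
  ... | yes _ = ≤-minimum _
  ... | no _  = ≤-refl
  x-lowers (presentY _) k w = ≤-refl
  x-lowers (yFirst i _) k w with k ≟ i
  ... | yes _ = ≤-minimum _
  ... | no _  = ≤-refl

  y-raises : ∀ q l w → ⟦ q ⟧ w ≤ ⟦ q ⟧ (y l ∷ w)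
  y-raises (absentX _) l w = ≤-refl
  y-raises (presentY j) l w with l ≟ j
  ... | yes _ = ≤-maximum _
  ... | no _  = ≤-refl
  y-raises (yFirst _ j) l w with l ≟ j
  ... | yes _ = ≤-maximum _
  ... | no _  = ≤-refl

  swap-raises : ∀ q k l w → ⟦ q ⟧ (x k ∷ y l ∷ w) ≤ ⟦ q ⟧ (y l ∷ x k ∷ w)
  swap-raises (absentX i) k l w with k ≟ i
  ... | yes _ = ≤-minimum _
  ... | no _  = ≤-refl
  swap-raises (presentY _) k l w = ≤-refl
  swap-raises (yFirst i _) k l w with k ≟ i
  ... | yes _ = ≤-minimum _
  ... | no _  = ≤-refl

  swap-invisible : ∀ q k l w → ⟦ q ⟧ (x k ∷ y l ∷ w) ≡ ⟦ q ⟧ (y l ∷ x k ∷ w) ⊎ q ≡ yFirst k l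
  swap-invisible q k l w with xView k q | yView l q
  ... | misses e | _ rewrite e = inj₁ refl
  ... | _ | misses e rewrite e = inj₁ refl
  ... | yFirst-k _ | yFirst-l _ = inj₂ refl

  _⊑_ : Word m n → Word m n → Set
  u ⊑ w = ∀ q → ⟦ q ⟧ u ≤ ⟦ q ⟧ w

  BubStep⇒⊑ : BubStep u w → u ⊑ w
  BubStep⇒⊑ (indel _ _ (del p s .(x k) (isX k))) q = ⟦⟧-prefix-mono q p (x-lowers q k s)
  BubStep⇒⊑ (indel _ _ (ins p s .(y l) (isY l))) q = ⟦⟧-prefix-mono q p (y-raises q l s)
  BubStep⇒⊑ (transp _ _ (swap p s .(x k) .(y l) (isX k) (isY l))) q =
    ⟦⟧-prefix-mono q p (swap-raises q k l s)

  ≤bub⇒⊑ : u ≤bub w → u ⊑ w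
  ≤bub⇒⊑ ε          q = ≤-refl
  ≤bub⇒⊑ (st ◅ sts) q = ≤-trans (BubStep⇒⊑ st q) (≤bub⇒⊑ sts q)

  ∉⇒absentX : ∀ {i} w → All (x i ≢_) w → ⟦ absentX i ⟧ w ≡ true
  ∉⇒absentX []          []         = refl
  ∉⇒absentX {i} (x k ∷ w) (x≢ ∷ x∉) =
    trans (⟦⟧-miss (absentX i) (x k) w (stopIf-no (k ≟ i) (x≢ ∘ cong x ∘ sym))) (∉⇒absentX w x∉)
  ∉⇒absentX (y _ ∷ w)   (_ ∷ x∉)  = ∉⇒absentX w x∉

  ∉⇒¬presentY : ∀ {j} w → All (y j ≢_) w → ⟦ presentY j ⟧ w ≡ false
  ∉⇒¬presentY []          []         = refl
  ∉⇒¬presentY {j} (y l ∷ w) (y≢ ∷ y∉) =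
    trans (⟦⟧-miss (presentY j) (y l) w (stopIf-no (l ≟ j) (y≢ ∘ cong y ∘ sym))) (∉⇒¬presentY w y∉)
  ∉⇒¬presentY (x _ ∷ w)   (_ ∷ y∉)  = ∉⇒¬presentY w y∉

  absentX⇒yFirst≡presentY : ∀ {i j} w → ⟦ absentX i ⟧ w ≡ true → ⟦ yFirst i j ⟧ w ≡ ⟦ presentY j ⟧ w
  absentX⇒yFirst≡presentY [] _ = refl
  absentX⇒yFirst≡presentY {i} (x k ∷ w) h with k ≟ i
  absentX⇒yFirst≡presentY {i} (x k ∷ w) () | yes _
  ... | no _ = absentX⇒yFirst≡presentY w h
  absentX⇒yFirst≡presentY {j = j} (y l ∷ w) h with l ≟ j
  ... | yes _ = refl
  ... | no _  = absentX⇒yFirst≡presentY w h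

  yFirst≤presentY : ∀ i j w → ⟦ yFirst i j ⟧ w ≤ ⟦ presentY j ⟧ w
  yFirst≤presentY i j []      = ≤-refl
  yFirst≤presentY i j (x k ∷ w) with k ≟ i
  ... | yes _ = ≤-minimum _
  ... | no _  = yFirst≤presentY i j w
  yFirst≤presentY i j (y l ∷ w) with l ≟ j
  ... | yes _ = ≤-refl
  ... | no _  = yFirst≤presentY i j w

  ¬presentY⇒¬yFirst : ∀ i j w → ⟦ presentY j ⟧ w ≡ false → ⟦ yFirst i j ⟧ w ≡ false
  ¬presentY⇒¬yFirst i j w h = ≤-antisym (subst (⟦ yFirst i j ⟧ w ≤_) h (yFirst≤presentY i j w)) (≤-minimum _)

  presentY⇒absentX≤yFirst : ∀ i j w → ⟦ presentY j ⟧ w ≡ true → ⟦ absentX i ⟧ w ≤ ⟦ yFirst i j ⟧ w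
  presentY⇒absentX≤yFirst i j [] ()
  presentY⇒absentX≤yFirst i j (x k ∷ w) h with k ≟ i
  ... | yes _ = ≤-refl
  ... | no _  = presentY⇒absentX≤yFirst i j w h
  presentY⇒absentX≤yFirst i j (y l ∷ w) h with l ≟ j
  ... | yes _ = ≤-maximum _
  ... | no _  = presentY⇒absentX≤yFirst i j w h

  x-after-head : ∀ {t k} w → Linked _<ᶠ_ (t ∷ mapMaybe xIndex w) → ⟦ absentX k ⟧ w ≡ false → t <ᶠ k
  x-after-head {k = k} (x t′ ∷ w) (t<t′ ∷ sorted) h with t′ ≟ k
  ... | yes refl = t<t′
  ... | no _     = <-trans t<t′ (x-after-head w sorted h)
  x-after-head (y _ ∷ w) sorted h = x-after-head w sorted h

  y-after-head : ∀ {t l} w → Linked _<ᶠ_ (t ∷ mapMaybe yIndex w) → ⟦ presentY l ⟧ w ≡ true → t <ᶠ l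
  y-after-head {l = l} (y t′ ∷ w) (t<t′ ∷ sorted) h with t′ ≟ l
  ... | yes refl = t<t′
  ... | no _     = <-trans t<t′ (y-after-head w sorted h)
  y-after-head (x _ ∷ w) sorted h = y-after-head w sorted h

  yFirst-monoˣ : ∀ {k k′} j w → Linked _<ᶠ_ (mapMaybe xIndex w) → k <ᶠ k′ →
                 ⟦ absentX k ⟧ w ≡ false → ⟦ yFirst k j ⟧ w ≤ ⟦ yFirst k′ j ⟧ w
  yFirst-monoˣ {k} {k′} j (x t ∷ w) sorted k<k′ h with t ≟ k | t ≟ k′
  ... | yes _ | _        = ≤-minimum _
  ... | no _  | yes refl = ⊥-elim (<-asym k<k′ (x-after-head w sorted h))
  ... | no _  | no _     = yFirst-monoˣ j w (Linked.tail sorted) k<k′ h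
  yFirst-monoˣ j (y l ∷ w) sorted k<k′ h with l ≟ j
  ... | yes _ = ≤-refl
  ... | no _  = yFirst-monoˣ j w sorted k<k′ h

  yFirst-antimonoʸ : ∀ {l l′} i w → Linked _<ᶠ_ (mapMaybe yIndex w) → l <ᶠ l′ →
                     ⟦ presentY l ⟧ w ≡ true → ⟦ yFirst i l′ ⟧ w ≤ ⟦ yFirst i l ⟧ w
  yFirst-antimonoʸ {l} {l′} i (y t ∷ w) sorted l<l′ h with t ≟ l | t ≟ l′
  ... | yes _ | _        = ≤-maximum _
  ... | no _  | yes refl = ⊥-elim (<-asym l<l′ (y-after-head w sorted h))
  ... | no _  | no _     = yFirst-antimonoʸ i w (Linked.tail sorted) l<l′ h
  yFirst-antimonoʸ i (x k ∷ w) sorted l<l′ h with k ≟ i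
  ... | yes _ = ≤-refl
  ... | no _  = yFirst-antimonoʸ i w sorted l<l′ h

  sorted-adjacentˣ : ∀ (p : Word m n) {k k′ s} → Linked _<ᶠ_ (mapMaybe xIndex (p ++ x k ∷ x k′ ∷ s)) → k <ᶠ k′
  sorted-adjacentˣ []        sorted = Linked.head sorted
  sorted-adjacentˣ (x _ ∷ p) sorted = sorted-adjacentˣ p (Linked.tail sorted)
  sorted-adjacentˣ (y _ ∷ p) sorted = sorted-adjacentˣ p sorted

  sorted-adjacentʸ : ∀ (p : Word m n) {l l′ s} → Linked _<ᶠ_ (mapMaybe yIndex (p ++ y l ∷ y l′ ∷ s)) → l <ᶠ l′
  sorted-adjacentʸ []        sorted = Linked.head sorted
  sorted-adjacentʸ (y _ ∷ p) sorted = sorted-adjacentʸ p (Linked.tail sorted)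
  sorted-adjacentʸ (x _ ∷ p) sorted = sorted-adjacentʸ p sorted

  yFirst-hits-as-presentY : ∀ {i j c} → x i ≢ c → hit (yFirst i j) c ≡ hit (presentY j) c
  yFirst-hits-as-presentY {i} {c = x k} x≢ = stopIf-no (k ≟ i) (x≢ ∘ cong x ∘ sym)
  yFirst-hits-as-presentY     {c = y _} _  = refl

  yFirst-hits-as-absentX : ∀ {i j c} → y j ≢ c → hit (yFirst i j) c ≡ hit (absentX i) c
  yFirst-hits-as-absentX         {c = x _} _  = refl
  yFirst-hits-as-absentX {j = j} {c = y l} y≢ = stopIf-no (l ≟ j) (y≢ ∘ cong y ∘ sym)

  yFirst-hits-asˣ : ∀ {i i′ j c} → x i ≢ c → x i′ ≢ c → hit (yFirst i j) c ≡ hit (yFirst i′ j) c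
  yFirst-hits-asˣ {i} {i′} {c = x k} x≢ x′≢ =
    trans (stopIf-no (k ≟ i) (x≢ ∘ cong x ∘ sym)) (sym (stopIf-no (k ≟ i′) (x′≢ ∘ cong x ∘ sym)))
  yFirst-hits-asˣ {c = y _} _ _ = refl

  yFirst-hits-asʸ : ∀ {i j j′ c} → y j ≢ c → y j′ ≢ c → hit (yFirst i j) c ≡ hit (yFirst i j′) c
  yFirst-hits-asʸ {c = x _} _ _ = refl
  yFirst-hits-asʸ {j = j} {j′} {c = y l} y≢ y′≢ =
    trans (stopIf-no (l ≟ j) (y≢ ∘ cong y ∘ sym)) (sym (stopIf-no (l ≟ j′) (y′≢ ∘ cong y ∘ sym)))

  yFirst-lastˣ : ∀ {k} j p → All (x k ≢_) p →
                 ⟦ yFirst k j ⟧ (p ++ [ x k ]) ≡ ⟦ presentY j ⟧ (p ++ [ x k ])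
  yFirst-lastˣ {k} j p k∉p =
    ⟦⟧-++ _≡_ refl (yFirst k j) (presentY j) p (All.map yFirst-hits-as-presentY k∉p) (yFirst-here-x k j [])

  yFirst-lastʸ : ∀ {l} i p → All (y l ≢_) p →
                 ⟦ yFirst i l ⟧ (p ++ [ y l ]) ≡ ⟦ absentX i ⟧ (p ++ [ y l ])
  yFirst-lastʸ {l} i p l∉p =
    ⟦⟧-++ _≡_ refl (yFirst i l) (absentX i) p (All.map yFirst-hits-as-absentX l∉p) (yFirst-here-y i l [])

  yFirst-adjacentˣ : ∀ {k k′} j p s → k ≢ k′ → All (x k ≢_) p → All (x k′ ≢_) p →
                     ⟦ yFirst k j ⟧ (p ++ x k ∷ x k′ ∷ s) ≡ ⟦ yFirst k′ j ⟧ (p ++ x k ∷ x k′ ∷ s)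
  yFirst-adjacentˣ {k} {k′} j p s k≢k′ k∉p k′∉p =
    ⟦⟧-++ _≡_ refl (yFirst k j) (yFirst k′ j) p
      (All.zipWith (λ (k≢ , k′≢) → yFirst-hits-asˣ k≢ k′≢) (k∉p , k′∉p))
      (trans (yFirst-here-x k j (x k′ ∷ s))
        (sym (trans (⟦⟧-miss (yFirst k′ j) (x k) (x k′ ∷ s) (stopIf-no (k ≟ k′) k≢k′)) (yFirst-here-x k′ j s))))

  yFirst-adjacentʸ : ∀ {l l′} i p s → l ≢ l′ → All (y l ≢_) p → All (y l′ ≢_) p →
                     ⟦ yFirst i l ⟧ (p ++ y l ∷ y l′ ∷ s) ≡ ⟦ yFirst i l′ ⟧ (p ++ y l ∷ y l′ ∷ s)
  yFirst-adjacentʸ {l} {l′} i p s l≢l′ l∉p l′∉p =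
    ⟦⟧-++ _≡_ refl (yFirst i l) (yFirst i l′) p
      (All.zipWith (λ (l≢ , l′≢) → yFirst-hits-asʸ l≢ l′≢) (l∉p , l′∉p))
      (trans (yFirst-here-y i l (y l′ ∷ s))
        (sym (trans (⟦⟧-miss (yFirst i l′) (y l) (y l′ ∷ s) (stopIf-no (l ≟ l′) l≢l′)) (yFirst-here-y i l′ s))))

  later∉earlier : ∀ (p : Word m n) {r} → Unique (p ++ r) → All (λ a → All (a ≢_) p) r
  later∉earlier []      _            = All.universal (λ _ → []) _
  later∉earlier (c ∷ p) (c∉ ∷ uniq) =
    All.zipWith (λ (c≢a , a∉p) → (c≢a ∘ sym) ∷ a∉p) (++⁻ʳ p c∉ , later∉earlier p uniq)

  Unique-++⁻ʳ : ∀ (p : Word m n) {r} → Unique (p ++ r) → Unique r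
  Unique-++⁻ʳ []      uniq       = uniq
  Unique-++⁻ʳ (_ ∷ p) (_ ∷ uniq) = Unique-++⁻ʳ p uniq

  Shuf-tail : ∀ {a} → Shuf (a ∷ w) → Shuf w
  Shuf-tail {a = x _} (_ ∷ uniq , sortedX , sortedY) = uniq , Linked.tail sortedX , sortedY
  Shuf-tail {a = y _} (_ ∷ uniq , sortedX , sortedY) = uniq , sortedX , Linked.tail sortedY

  tails-agreeˣ : ∀ {t} u w → All (x t ≢_) u → All (x t ≢_) w →
                 (∀ q → ⟦ q ⟧ (x t ∷ u) ≡ ⟦ q ⟧ (x t ∷ w)) → ∀ q → ⟦ q ⟧ u ≡ ⟦ q ⟧ w
  tails-agreeˣ {t} u w t∉u t∉w agree q with xView t q
  ... | misses e  = trans (sym (⟦⟧-miss q (x t) u e)) (trans (agree q) (⟦⟧-miss q (x t) w e))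
  ... | absentX-k = trans (∉⇒absentX u t∉u) (sym (∉⇒absentX w t∉w))
  ... | yFirst-k j =
    trans (absentX⇒yFirst≡presentY u (∉⇒absentX u t∉u))
      (trans (agree (presentY j)) (sym (absentX⇒yFirst≡presentY w (∉⇒absentX w t∉w))))

  tails-agreeʸ : ∀ {t} u w → All (y t ≢_) u → All (y t ≢_) w →
                 (∀ q → ⟦ q ⟧ (y t ∷ u) ≡ ⟦ q ⟧ (y t ∷ w)) → ∀ q → ⟦ q ⟧ u ≡ ⟦ q ⟧ w
  tails-agreeʸ {t} u w t∉u t∉w agree q with yView t q
  ... | misses e   = trans (sym (⟦⟧-miss q (y t) u e)) (trans (agree q) (⟦⟧-miss q (y t) w e))
  ... | presentY-l = trans (∉⇒¬presentY u t∉u) (sym (∉⇒¬presentY w t∉w))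
  ... | yFirst-l i =
    trans (¬presentY⇒¬yFirst i t u (∉⇒¬presentY u t∉u))
      (sym (¬presentY⇒¬yFirst i t w (∉⇒¬presentY w t∉w)))

  heads-agreeˣ : ∀ {t t′} u w → Shuf (x t ∷ u) → Shuf (x t′ ∷ w) →
                 (∀ q → ⟦ q ⟧ (x t ∷ u) ≡ ⟦ q ⟧ (x t′ ∷ w)) → t ≡ t′
  heads-agreeˣ {t} {t′} u w su sw agree with t ≟ t′
  ... | yes t≡t′ = t≡t′
  ... | no t≢t′  = ⊥-elim (<-asym (x-after-head u (proj₁ (proj₂ su)) t′∈u) (x-after-head w (proj₁ (proj₂ sw)) t∈w))
    where
      t′∈u : ⟦ absentX t′ ⟧ u ≡ false
      t′∈u = trans (sym (⟦⟧-miss (absentX t′) (x t) u (stopIf-no (t ≟ t′) t≢t′)))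
                   (trans (agree (absentX t′)) (absentX-here t′ w))
      t∈w : ⟦ absentX t ⟧ w ≡ false
      t∈w = trans (sym (⟦⟧-miss (absentX t) (x t′) w (stopIf-no (t′ ≟ t) (t≢t′ ∘ sym))))
                  (trans (sym (agree (absentX t))) (absentX-here t u))

  heads-agreeʸ : ∀ {t t′} u w → Shuf (y t ∷ u) → Shuf (y t′ ∷ w) →
                 (∀ q → ⟦ q ⟧ (y t ∷ u) ≡ ⟦ q ⟧ (y t′ ∷ w)) → t ≡ t′
  heads-agreeʸ {t} {t′} u w su sw agree with t ≟ t′
  ... | yes t≡t′ = t≡t′
  ... | no t≢t′  = ⊥-elim (<-asym (y-after-head u (proj₂ (proj₂ su)) t′∈u) (y-after-head w (proj₂ (proj₂ sw)) t∈w))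
    where
      t′∈u : ⟦ presentY t′ ⟧ u ≡ true
      t′∈u = trans (sym (⟦⟧-miss (presentY t′) (y t) u (stopIf-no (t ≟ t′) t≢t′)))
                   (trans (agree (presentY t′)) (presentY-here t′ w))
      t∈w : ⟦ presentY t ⟧ w ≡ true
      t∈w = trans (sym (⟦⟧-miss (presentY t) (y t′) w (stopIf-no (t′ ≟ t) (t≢t′ ∘ sym))))
                  (trans (sym (agree (presentY t))) (presentY-here t u))

  signature-injective : ∀ u w → Shuf u → Shuf w → (∀ q → ⟦ q ⟧ u ≡ ⟦ q ⟧ w) → u ≡ w
  signature-injective [] [] _ _ _ = refl
  signature-injective [] (x t ∷ w) _ _ agree =
    ⊥-elim (true≢false (trans (agree (absentX t)) (absentX-here t w)))
  signature-injective [] (y t ∷ w) _ _ agree =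
    ⊥-elim (true≢false (sym (trans (agree (presentY t)) (presentY-here t w))))
  signature-injective (x t ∷ u) [] _ _ agree =
    ⊥-elim (true≢false (trans (sym (agree (absentX t))) (absentX-here t u)))
  signature-injective (y t ∷ u) [] _ _ agree =
    ⊥-elim (true≢false (sym (trans (sym (agree (presentY t))) (presentY-here t u))))
  signature-injective (x t ∷ u) (y t′ ∷ w) _ _ agree =
    ⊥-elim (true≢false (sym (trans (sym (yFirst-here-x t t′ u)) (trans (agree (yFirst t t′)) (yFirst-here-y t t′ w)))))
  signature-injective (y t ∷ u) (x t′ ∷ w) _ _ agree =
    ⊥-elim (true≢false (trans (sym (yFirst-here-y t′ t u)) (trans (agree (yFirst t′ t)) (yFirst-here-x t′ t w))))
  signature-injective (x t ∷ u) (x t′ ∷ w) su sw agree with heads-agreeˣ u w su sw agree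
  signature-injective (x t ∷ u) (x t ∷ w) su@(t∉u ∷ _ , _) sw@(t∉w ∷ _ , _) agree | refl =
    cong (x t ∷_) (signature-injective u w (Shuf-tail su) (Shuf-tail sw) (tails-agreeˣ u w t∉u t∉w agree))
  signature-injective (y t ∷ u) (y t′ ∷ w) su sw agree with heads-agreeʸ u w su sw agree
  signature-injective (y t ∷ u) (y t ∷ w) su@(t∉u ∷ _ , _) sw@(t∉w ∷ _ , _) agree | refl =
    cong (y t ∷_) (signature-injective u w (Shuf-tail su) (Shuf-tail sw) (tails-agreeʸ u w t∉u t∉w agree))

  ⊑-antisym : Shuf u → Shuf w → u ⊑ w → w ⊑ u → u ≡ w
  ⊑-antisym {u} {w} su sw u⊑w w⊑u = signature-injective u w su sw (λ q → ≤-antisym (u⊑w q) (w⊑u q))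

  Gapless : Word m n → Word m n → Set
  Gapless u v = ∀ {w} → Shuf w → u ⊑ w → w ⊑ v → w ⊑ u ⊎ v ⊑ w

  transp-gapless : ∀ p s k l → Gapless (p ++ x k ∷ y l ∷ s) (p ++ y l ∷ x k ∷ s)
  transp-gapless p s k l {w} _ u⊑w w⊑v with ⟦ yFirst k l ⟧ w in pivot
  ... | false = inj₁ w⊑u
    where
      w⊑u : w ⊑ (p ++ x k ∷ y l ∷ s)
      w⊑u q with swap-invisible q k l s
      ... | inj₁ e    = ≤-trans (w⊑v q) (≤-reflexive (sym (⟦⟧-prefix-cong q p e)))
      ... | inj₂ refl = ≡false⇒≤ _ pivot
  ... | true = inj₂ v⊑w
    where
      v⊑w : (p ++ y l ∷ x k ∷ s) ⊑ w
      v⊑w q with swap-invisible q k l s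
      ... | inj₁ e    = ≤-trans (≤-reflexive (sym (⟦⟧-prefix-cong q p e))) (u⊑w q)
      ... | inj₂ refl = ≡true⇒≥ _ pivot

  right-deletion-bound : ∀ p s k j → EndOrX s → Shuf (p ++ x k ∷ s) → Shuf w → w ⊑ (p ++ s) →
                         ⟦ absentX k ⟧ w ≡ false → ⟦ yFirst k j ⟧ w ≤ ⟦ yFirst k j ⟧ (p ++ x k ∷ s)
  right-deletion-bound {w} p .[] k j end su _ w⊑v _ = begin
    ⟦ yFirst k j ⟧ w               ≤⟨ yFirst≤presentY k j w ⟩
    ⟦ presentY j ⟧ w               ≤⟨ w⊑v (presentY j) ⟩
    ⟦ presentY j ⟧ (p ++ [])       ≡⟨ sym (⟦⟧-++-∷-miss p [] refl) ⟩
    ⟦ presentY j ⟧ (p ++ [ x k ])  ≡⟨ sym (yFirst-lastˣ j p (All.head (later∉earlier p (proj₁ su)))) ⟩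
    ⟦ yFirst k j ⟧ (p ++ [ x k ])  ∎
  right-deletion-bound {w} p .(x k′ ∷ s) k j (nxt .(x k′) s (isX k′)) su sw w⊑v x∈w = begin
    ⟦ yFirst k j ⟧ w                       ≤⟨ yFirst-monoˣ j w (proj₁ (proj₂ sw)) k<k′ x∈w ⟩
    ⟦ yFirst k′ j ⟧ w                      ≤⟨ w⊑v (yFirst k′ j) ⟩
    ⟦ yFirst k′ j ⟧ (p ++ x k′ ∷ s)        ≡⟨ sym (⟦⟧-++-∷-miss p (x k′ ∷ s) (stopIf-no (k ≟ k′) k≢k′)) ⟩
    ⟦ yFirst k′ j ⟧ (p ++ x k ∷ x k′ ∷ s)  ≡⟨ sym (yFirst-adjacentˣ j p s k≢k′ (All.head later) (All.head (All.tail later))) ⟩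
    ⟦ yFirst k j ⟧ (p ++ x k ∷ x k′ ∷ s)   ∎
    where
      k<k′ = sorted-adjacentˣ p (proj₁ (proj₂ su))
      k≢k′ = <⇒≢ k<k′
      later = later∉earlier p (proj₁ su)

  right-insertion-bound : ∀ p s l i → EndOrY s → Shuf (p ++ y l ∷ s) → Shuf w → (p ++ s) ⊑ w →
                          ⟦ presentY l ⟧ w ≡ true → ⟦ yFirst i l ⟧ (p ++ y l ∷ s) ≤ ⟦ yFirst i l ⟧ w
  right-insertion-bound {w} p .[] l i end sv _ u⊑w y∈w = begin
    ⟦ yFirst i l ⟧ (p ++ [ y l ])  ≡⟨ yFirst-lastʸ i p (All.head (later∉earlier p (proj₁ sv))) ⟩
    ⟦ absentX i ⟧ (p ++ [ y l ])   ≡⟨ ⟦⟧-++-∷-miss p [] refl ⟩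
    ⟦ absentX i ⟧ (p ++ [])        ≤⟨ u⊑w (absentX i) ⟩
    ⟦ absentX i ⟧ w                ≤⟨ presentY⇒absentX≤yFirst i l w y∈w ⟩
    ⟦ yFirst i l ⟧ w               ∎
  right-insertion-bound {w} p .(y l′ ∷ s) l i (nxt .(y l′) s (isY l′)) sv sw u⊑w y∈w = begin
    ⟦ yFirst i l ⟧ (p ++ y l ∷ y l′ ∷ s)   ≡⟨ yFirst-adjacentʸ i p s l≢l′ (All.head later) (All.head (All.tail later)) ⟩
    ⟦ yFirst i l′ ⟧ (p ++ y l ∷ y l′ ∷ s)  ≡⟨ ⟦⟧-++-∷-miss p (y l′ ∷ s) (stopIf-no (l ≟ l′) l≢l′) ⟩
    ⟦ yFirst i l′ ⟧ (p ++ y l′ ∷ s)        ≤⟨ u⊑w (yFirst i l′) ⟩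
    ⟦ yFirst i l′ ⟧ w                      ≤⟨ yFirst-antimonoʸ i w (proj₂ (proj₂ sw)) l<l′ y∈w ⟩
    ⟦ yFirst i l ⟧ w                       ∎
    where
      l<l′ = sorted-adjacentʸ p (proj₂ (proj₂ sv))
      l≢l′ = <⇒≢ l<l′
      later = later∉earlier p (proj₁ sv)

  right-deletion-gapless : ∀ p s k → EndOrX s → Shuf (p ++ x k ∷ s) → Gapless (p ++ x k ∷ s) (p ++ s)
  right-deletion-gapless p s k x-or-end su {w} sw u⊑w w⊑v with ⟦ absentX k ⟧ w in pivot
  ... | false = inj₁ w⊑u
    where
      w⊑u : w ⊑ (p ++ x k ∷ s)
      w⊑u q with xView k q
      ... | misses e   = ≤-trans (w⊑v q) (≤-reflexive (sym (⟦⟧-++-∷-miss p s e)))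
      ... | absentX-k  = ≡false⇒≤ _ pivot
      ... | yFirst-k j = right-deletion-bound p s k j x-or-end su sw w⊑v pivot
  ... | true = inj₂ v⊑w
    where
      k∉v : All (x k ≢_) (p ++ s)
      k∉v = ++⁺ (All.head (later∉earlier p (proj₁ su))) (AllPairs.head (Unique-++⁻ʳ p (proj₁ su)))
      v⊑w : (p ++ s) ⊑ w
      v⊑w q with xView k q
      ... | misses e   = ≤-trans (≤-reflexive (sym (⟦⟧-++-∷-miss p s e))) (u⊑w q)
      ... | absentX-k  = ≡true⇒≥ _ pivot
      ... | yFirst-k j = begin
        ⟦ yFirst k j ⟧ (p ++ s)        ≡⟨ absentX⇒yFirst≡presentY (p ++ s) (∉⇒absentX (p ++ s) k∉v) ⟩
        ⟦ presentY j ⟧ (p ++ s)        ≡⟨ sym (⟦⟧-++-∷-miss p s refl) ⟩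
        ⟦ presentY j ⟧ (p ++ x k ∷ s)  ≤⟨ u⊑w (presentY j) ⟩
        ⟦ presentY j ⟧ w               ≡⟨ sym (absentX⇒yFirst≡presentY w pivot) ⟩
        ⟦ yFirst k j ⟧ w               ∎

  right-insertion-gapless : ∀ p s l → EndOrY s → Shuf (p ++ y l ∷ s) → Gapless (p ++ s) (p ++ y l ∷ s)
  right-insertion-gapless p s l y-or-end sv {w} sw u⊑w w⊑v with ⟦ presentY l ⟧ w in pivot
  ... | false = inj₁ w⊑u
    where
      w⊑u : w ⊑ (p ++ s)
      w⊑u q with yView l q
      ... | misses e   = ≤-trans (w⊑v q) (≤-reflexive (⟦⟧-++-∷-miss p s e))
      ... | presentY-l = ≡false⇒≤ _ pivot
      ... | yFirst-l i = ≡false⇒≤ _ (¬presentY⇒¬yFirst i l w pivot)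
  ... | true = inj₂ v⊑w
    where
      v⊑w : (p ++ y l ∷ s) ⊑ w
      v⊑w q with yView l q
      ... | misses e   = ≤-trans (≤-reflexive (⟦⟧-++-∷-miss p s e)) (u⊑w q)
      ... | presentY-l = ≡true⇒≥ _ pivot
      ... | yFirst-l i = right-insertion-bound p s l i y-or-end sv sw u⊑w pivot

  insertion-≢ : ∀ (p : Word m n) a s → p ++ a ∷ s ≢ p ++ s
  insertion-≢ p a s = 1+n≢n ∘ cong length ∘ ++-cancelˡ p (a ∷ s) s

  IsX⇒≢IsY : ∀ {a b : Letter m n} → IsX a → IsY b → a ≢ b
  IsX⇒≢IsY (isX _) (isY _) ()

  BubStep⇒≢ : BubStep u w → u ≢ w
  BubStep⇒≢ (indel _ _ (del p s a _)) = insertion-≢ p a s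
  BubStep⇒≢ (indel _ _ (ins p s a _)) = insertion-≢ p a s ∘ sym
  BubStep⇒≢ (transp _ _ (swap p s _ _ a∈X b∈Y)) = IsX⇒≢IsY a∈X b∈Y ∘ ∷-injectiveˡ ∘ ++-cancelˡ p _ _

  gapless-step⇒⋖ : Shuf u → Shuf v → BubStep u v → Gapless u v → u ⋖bub v
  gapless-step⇒⋖ {u} {v} su sv step gapless = (step ◅ ε , BubStep⇒≢ step) , no-middle
    where
      no-middle : ¬ (Σ (Word m n) λ w → Shuf w × u <bub w × w <bub v)
      no-middle (w , sw , (u≤w , u≢w) , (w≤v , w≢v)) with gapless sw (≤bub⇒⊑ u≤w) (≤bub⇒⊑ w≤v)
      ... | inj₁ w⊑u = u≢w (⊑-antisym su sw (≤bub⇒⊑ u≤w) w⊑u)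
      ... | inj₂ v⊑w = w≢v (⊑-antisym sw sv (≤bub⇒⊑ w≤v) v⊑w)

  Transp⇒⋖ : Shuf u → Shuf v → Transp u v → u ⋖bub v
  Transp⇒⋖ su sv t@(swap p s .(x k) .(y l) (isX k) (isY l)) =
    gapless-step⇒⋖ su sv (transp su sv t) (transp-gapless p s k l)

  RightIndel⇒⋖ : Shuf u → Shuf v → RightIndel u v → u ⋖bub v
  RightIndel⇒⋖ su sv (rdel p s .(x k) (isX k) x-or-end) =
    gapless-step⇒⋖ su sv (indel su sv (del p s (x k) (isX k))) (right-deletion-gapless p s k x-or-end su)
  RightIndel⇒⋖ su sv (rins p s .(y l) (isY l) y-or-end) =
    gapless-step⇒⋖ su sv (indel su sv (ins p s (y l) (isY l))) (right-insertion-gapless p s l y-or-end sv)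

  _≟ₗ_ : DecidableEquality (Letter m n)
  x i ≟ₗ x k = map′ (cong x) (λ { refl → refl }) (i ≟ k)
  y j ≟ₗ y l = map′ (cong y) (λ { refl → refl }) (j ≟ l)
  x _ ≟ₗ y _ = no λ ()
  y _ ≟ₗ x _ = no λ ()

  BubStep⇒Shufʳ : BubStep u w → Shuf w
  BubStep⇒Shufʳ (indel _ sw _)  = sw
  BubStep⇒Shufʳ (transp _ sw _) = sw

  ⋖⇒BubStep : u ⋖bub v → BubStep u v
  ⋖⇒BubStep ((ε , u≢u) , _) = ⊥-elim (u≢u refl)
  ⋖⇒BubStep {v = v} ((_◅_ {j = w} step rest , _) , no-middle) with ≡-dec _≟ₗ_ w v
  ... | yes refl = step
  ... | no w≢v   = ⊥-elim (no-middle (w , BubStep⇒Shufʳ step , (step ◅ ε , BubStep⇒≢ step) , (rest , w≢v)))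

  two-steps-¬⋖ : BubStep u w → BubStep w v → ¬ (u ⋖bub v)
  two-steps-¬⋖ {w = w} step₁ step₂ (_ , no-middle) =
    no-middle (w , BubStep⇒Shufʳ step₁ , (step₁ ◅ ε , BubStep⇒≢ step₁) , (step₂ ◅ ε , BubStep⇒≢ step₂))

  Unique-swap : ∀ (p : Word m n) {a b s} → Unique (p ++ a ∷ b ∷ s) → Unique (p ++ b ∷ a ∷ s)
  Unique-swap []      ((a≢b ∷ a∉s) ∷ b∉s ∷ uniq) = ((a≢b ∘ sym) ∷ b∉s) ∷ a∉s ∷ uniq
  Unique-swap (c ∷ p) {a} {b} (c∉ ∷ uniq) =
    All-resp-↭ (++⁺ˡ p (_↭_.swap a b _↭_.refl)) c∉ ∷ Unique-swap p uniq

  mapMaybe-++ : ∀ {B : Set} (f : Letter m n → Maybe B) p r → mapMaybe f (p ++ r) ≡ mapMaybe f p ++ mapMaybe f r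
  mapMaybe-++ f p r = trans (cong catMaybes (map-++ f p r)) (catMaybes-++ (map f p) (map f r))

  mapMaybe-prefix-cong : ∀ {B : Set} (f : Letter m n → Maybe B) p →
                         mapMaybe f r ≡ mapMaybe f r′ → mapMaybe f (p ++ r) ≡ mapMaybe f (p ++ r′)
  mapMaybe-prefix-cong {r} {r′} f p e =
    trans (mapMaybe-++ f p r) (trans (cong (mapMaybe f p ++_) e) (sym (mapMaybe-++ f p r′)))

  mixed-swap-indices : ∀ {a b : Letter m n} s → IsX a × IsY b ⊎ IsY a × IsX b →
                       mapMaybe xIndex (a ∷ b ∷ s) ≡ mapMaybe xIndex (b ∷ a ∷ s) ×
                       mapMaybe yIndex (a ∷ b ∷ s) ≡ mapMaybe yIndex (b ∷ a ∷ s)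
  mixed-swap-indices s (inj₁ (isX _ , isY _)) = refl , refl
  mixed-swap-indices s (inj₂ (isY _ , isX _)) = refl , refl

  Shuf-swap : ∀ (p : Word m n) {a b s} → IsX a × IsY b ⊎ IsY a × IsX b → Shuf (p ++ a ∷ b ∷ s) → Shuf (p ++ b ∷ a ∷ s)
  Shuf-swap p {s = s} mixed (uniq , sortedX , sortedY) =
    Unique-swap p uniq ,
    subst (Linked _<ᶠ_) (mapMaybe-prefix-cong xIndex p (proj₁ (mixed-swap-indices s mixed))) sortedX ,
    subst (Linked _<ᶠ_) (mapMaybe-prefix-cong yIndex p (proj₂ (mixed-swap-indices s mixed))) sortedY

  deletion-after : ∀ (p : Word m n) b {a} s → IsX a → Indel (p ++ b ∷ a ∷ s) (p ++ b ∷ s)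
  deletion-after p b s a∈X = subst₂ Indel (++-assoc p [ b ] _) (++-assoc p [ b ] s) (del (p ++ [ b ]) s _ a∈X)

  insertion-after : ∀ (p : Word m n) b {a} s → IsY a → Indel (p ++ b ∷ s) (p ++ b ∷ a ∷ s)
  insertion-after p b s a∈Y = subst₂ Indel (++-assoc p [ b ] s) (++-assoc p [ b ] _) (ins (p ++ [ b ]) s _ a∈Y)

  ⋖-BubStep⇒Transp⊎RightIndel : u ⋖bub v → BubStep u v → Transp u v ⊎ RightIndel u v
  ⋖-BubStep⇒Transp⊎RightIndel _ (transp _ _ t) = inj₁ t
  ⋖-BubStep⇒Transp⊎RightIndel _ (indel _ _ (del p [] a a∈X)) = inj₂ (rdel p [] a a∈X end)
  ⋖-BubStep⇒Transp⊎RightIndel _ (indel _ _ (del p (x k ∷ s) a a∈X)) =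
    inj₂ (rdel p (x k ∷ s) a a∈X (nxt (x k) s (isX k)))
  ⋖-BubStep⇒Transp⊎RightIndel cover (indel su sv (del p (y l ∷ s) .(x k) (isX k))) =
    ⊥-elim (two-steps-¬⋖ (transp su sw (swap p s (x k) (y l) (isX k) (isY l)))
                         (indel sw sv (deletion-after p (y l) s (isX k))) cover)
    where sw = Shuf-swap p (inj₁ (isX k , isY l)) su
  ⋖-BubStep⇒Transp⊎RightIndel _ (indel _ _ (ins p [] a a∈Y)) = inj₂ (rins p [] a a∈Y end)
  ⋖-BubStep⇒Transp⊎RightIndel _ (indel _ _ (ins p (y l ∷ s) a a∈Y)) =
    inj₂ (rins p (y l ∷ s) a a∈Y (nxt (y l) s (isY l)))
  ⋖-BubStep⇒Transp⊎RightIndel cover (indel su sv (ins p (x k ∷ s) .(y l) (isY l))) =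
    ⊥-elim (two-steps-¬⋖ (indel su sw (insertion-after p (x k) s (isY l)))
                         (transp sw sv (swap p s (x k) (y l) (isX k) (isY l))) cover)
    where sw = Shuf-swap p (inj₂ (isY l , isX k)) sv

lemma3p5 : (m n : ℕ) (u v : Word m n) → Shuf u → Shuf v →
           (u ⋖bub v) ⇔ (Transp u v ⊎ RightIndel u v)
lemma3p5 m n u v su sv =
  mk⇔ (λ cover → ⋖-BubStep⇒Transp⊎RightIndel cover (⋖⇒BubStep cover))
      [ Transp⇒⋖ su sv , RightIndel⇒⋖ su sv ]′
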